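{- Let $T$ be a spider with center $v$ and $n$ edges, and let the lengths of the legs of $T$ be $m_1\ge m_2\ge\cdots\ge m_k$. If for each $i$ we have $$m_i\le\max\left(1,\ \log_2\left(\frac{n}{2i-1}\right)+1\right),$$ then $T$ has a graceful labeling $f$ with $f(v)=0$.
   Context: A spider is a tree with at most one vertex of degree greater than two, called the center; a leg is a path from the center to one of the leaves, and its length is its number of edges. A graceful labeling of a tree with $n$ edges is an injective map $f$ from its vertices to $\{0,1,\ldots,n\}$ such that the induced edge labels $|f(x)-f(y)|$ over all edges $xy$ are exactly $\{1,\ldots,n\}$. -}

module Defs where

open import Data.Nat using (ℕ; zero; suc; _+_; _*_; _∸_; _^_; _≤_; _<_)
open import Data.Fin using (Fin; zero; suc; toℕ; inject₁)
open import Data.Product using (Σ; _×_; _,_; ∃-syntax)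
open import Data.Sum using (_⊎_)
open import Function.Definitions using (Injective)
open import Relation.Binary.PropositionalEquality using (_≡_; refl; subst)

-- The spider with k legs of lengths m : Fin k → ℕ (leg j has m j edges).
-- Vertices: the center, and on leg j the vertices at distance p+1 from the
-- center, for p : Fin (m j).
data Vertex {k : ℕ} (m : Fin k → ℕ) : Set where
  center : Vertex m
  legV   : (j : Fin k) → Fin (m j) → Vertex m

-- Edges: each edge is identified by its endpoint farther from the center.
Edge : {k : ℕ} → (Fin k → ℕ) → Set
Edge {k} m = Σ (Fin k) λ j → Fin (m j)

innerAux : {k : ℕ} {m : Fin k → ℕ} (j : Fin k) {l : ℕ} →
           l ≡ m j → Fin l → Vertex m
innerAux j eq zero    = center
innerAux j eq (suc p) = legV j (subst Fin eq (inject₁ p))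

inner : {k : ℕ} {m : Fin k → ℕ} → Edge m → Vertex m
inner (j , p) = innerAux j refl p

outer : {k : ℕ} {m : Fin k → ℕ} → Edge m → Vertex m
outer (j , p) = legV j p

sumLegs : (k : ℕ) → (Fin k → ℕ) → ℕ
sumLegs zero    m = 0
sumLegs (suc k) m = m zero + sumLegs k (λ j → m (suc j))

absDiff : ℕ → ℕ → ℕ
absDiff a b = (a ∸ b) + (b ∸ a)

edgeLabel : {k : ℕ} {m : Fin k → ℕ} → (Vertex m → ℕ) → Edge m → ℕ
edgeLabel f e = absDiff (f (inner e)) (f (outer e))

record IsGraceful {k : ℕ} (m : Fin k → ℕ) (n : ℕ) (f : Vertex m → ℕ) : Set where
  field
    injective   : Injective _≡_ _≡_ f
    bounded     : ∀ x → f x ≤ n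
    labelsIn    : ∀ e → 1 ≤ edgeLabel f e × edgeLabel f e ≤ n
    labelsOnto  : ∀ d → 1 ≤ d → d ≤ n → ∃[ e ] edgeLabel f e ≡ d

module Submission where

-- Number the legs j = 0, …, k-1 and give the center label 0.  On a leg j
-- with at least two edges, the vertex at distance h from the leaf gets the
-- label (2j+1)·2^h.  Consecutive vertices of such a leg then carry labels
-- 2c and c, and the first one differs from the center by its own label, so
-- every edge is labelled by the label of its outer endpoint.  The hypothesis
-- of the theorem says precisely that these dyadic labels are at most n, and
-- the uniqueness of the factorisation odd·2^h makes them pairwise distinct.
-- The remaining vertices lie on legs of length one, whose single edge again
-- carries the label of its outer vertex; so it suffices to complete the
-- dyadic labels to a bijection from the n non-central vertices onto
-- {1, …, n}.

open import Defs
open import Data.Nat using (ℕ; _+_; _*_; _∸_; _^_; _≤_)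
open import Data.Fin using (Fin; toℕ)
open import Data.Sum using (_⊎_)
open import Data.Product using (_×_; ∃-syntax; _,_)
open import Relation.Binary.PropositionalEquality using (_≡_; refl)

open import Data.Nat as ℕ using (zero; suc; pred; _<_; z≤n; s≤s)
open import Data.Nat.Properties as ℕ using (≤-refl; ≤-trans)
open import Data.Fin using (zero; suc; fromℕ<; inject₁; punchOut; splitAt; join)
open import Data.Fin.Properties
  using (any?; _≟_; punchOut-injective; injective⇒≤; toℕ-fromℕ<; toℕ<n; toℕ-injective;
         toℕ-inject₁; splitAt-join; splitAt⁻¹-↑ˡ; splitAt⁻¹-↑ʳ)
open import Data.Product using (∃; proj₁; proj₂)
open import Data.Sum using (inj₁; inj₂; [_,_]′)
open import Data.Empty using (⊥-elim)
open import Function.Base using (_∘_)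
open import Function.Definitions using (Injective)
open import Relation.Nullary using (¬_; yes; no; contradiction)
open import Relation.Nullary.Decidable using (¬?; _×-dec_; _⊎-dec_; decidable-stable)
open import Relation.Unary using (Decidable)
open import Relation.Binary.PropositionalEquality
  using (_≢_; sym; trans; cong; subst; module ≡-Reasoning)

InjectiveOn : {N : ℕ} → (Fin N → Set) → (Fin N → Fin N) → Set
InjectiveOn D H = ∀ {x y} → D x → D y → H x ≡ H y → x ≡ y

-- An injective endomap of Fin N is surjective: if it missed y, composing
-- with punchOut would inject Fin N into Fin (N-1).
injective⇒surjective : ∀ {N} (H : Fin N → Fin N) → Injective _≡_ _≡_ H →
  ∀ y → ∃ λ x → H x ≡ y
injective⇒surjective {zero}  H inj ()
injective⇒surjective {suc N} H inj y with any? (λ x → H x ≟ y)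
... | yes hit  = hit
... | no  miss = contradiction (injective⇒≤ squeeze-injective) ℕ.1+n≰n
  where
  avoids : ∀ x → y ≢ H x
  avoids x eq = miss (x , sym eq)

  squeeze : Fin (suc N) → Fin N
  squeeze x = punchOut (avoids x)

  squeeze-injective : Injective _≡_ _≡_ squeeze
  squeeze-injective eq = inj (punchOut-injective (avoids _) (avoids _) eq)

module _ {N : ℕ} {D : Fin N → Set} (D? : Decidable D) where

  -- If D omits a point, every map misses some value on D: otherwise choosing
  -- preimages in D would give an injection of Fin N whose image lies in D,
  -- hence, being surjective, would hit the omitted point.
  freshValue : (H : Fin N → Fin N) {x₀ : Fin N} → ¬ D x₀ →
    ∃ λ y → ∀ x → D x → H x ≢ y
  freshValue H {x₀} ¬Dx₀ with any? (λ y → ¬? (any? (λ x → D? x ×-dec (H x ≟ y))))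
  ... | yes (y , unhit) = y , λ x Dx eq → unhit (x , Dx , eq)
  ... | no  allHit      = ⊥-elim (¬Dx₀ (subst D g≡x₀ (proj₁ (proj₂ (preimage y₀)))))
    where
    preimage : ∀ y → ∃ λ x → D x × H x ≡ y
    preimage y = decidable-stable (any? (λ x → D? x ×-dec (H x ≟ y)))
                                  (λ unhit → allHit (y , unhit))

    g : Fin N → Fin N
    g y = proj₁ (preimage y)

    g-injective : Injective _≡_ _≡_ g
    g-injective {a} {b} eq =
      trans (sym (proj₂ (proj₂ (preimage a))))
            (trans (cong H eq) (proj₂ (proj₂ (preimage b))))

    y₀ : Fin N
    y₀ = proj₁ (injective⇒surjective g g-injective x₀)

    g≡x₀ : g y₀ ≡ x₀
    g≡x₀ = proj₂ (injective⇒surjective g g-injective x₀)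

  addPoint : (H : Fin N → Fin N) → InjectiveOn D H → (x₀ : Fin N) →
    ∃ λ H′ → (∀ x → D x → H′ x ≡ H x) × InjectiveOn (λ x → D x ⊎ x ≡ x₀) H′
  addPoint H inj x₀ with D? x₀
  ... | yes Dx₀ = H , (λ _ _ → refl) , λ dx dy → inj (inD dx) (inD dy)
    where
    inD : ∀ {x} → D x ⊎ x ≡ x₀ → D x
    inD (inj₁ Dx)   = Dx
    inD (inj₂ refl) = Dx₀
  ... | no ¬Dx₀ with freshValue H ¬Dx₀
  ...   | y₀ , fresh = H′ , unchanged , inj′
    where
    H′ : Fin N → Fin N
    H′ x with x ≟ x₀
    ... | yes _ = y₀
    ... | no  _ = H x

    unchanged : ∀ x → D x → H′ x ≡ H x
    unchanged x Dx with x ≟ x₀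
    ... | yes refl = contradiction Dx ¬Dx₀
    ... | no  _    = refl

    inD : ∀ {x} → D x ⊎ x ≡ x₀ → x ≢ x₀ → D x
    inD (inj₁ Dx)  _   = Dx
    inD (inj₂ x≡x₀) x≢x₀ = contradiction x≡x₀ x≢x₀

    inj′ : InjectiveOn (λ x → D x ⊎ x ≡ x₀) H′
    inj′ {x} {y} dx dy eq with x ≟ x₀ | y ≟ x₀
    ... | yes refl | yes refl = refl
    ... | yes refl | no  y≢x₀ = ⊥-elim (fresh y (inD dy y≢x₀) (sym eq))
    ... | no  x≢x₀ | yes refl = ⊥-elim (fresh x (inD dx x≢x₀) eq)
    ... | no  x≢x₀ | no  y≢x₀ = inj (inD dx x≢x₀) (inD dy y≢x₀) eq

module _ {N : ℕ} {P : Fin N → Set} (P? : Decidable P)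
         (h : Fin N → Fin N) (h-injective : InjectiveOn P h) where

  Settled : ℕ → Fin N → Set
  Settled i x = P x ⊎ toℕ x < i

  Settled? : ∀ i → Decidable (Settled i)
  Settled? i x = P? x ⊎-dec (toℕ x ℕ.<? i)

  settled-suc : ∀ {i} (i<N : i < N) {x} → Settled (suc i) x → Settled i x ⊎ x ≡ fromℕ< i<N
  settled-suc _ (inj₁ Px) = inj₁ (inj₁ Px)
  settled-suc i<N {x} (inj₂ (s≤s x≤i)) with ℕ.m≤n⇒m<n∨m≡n x≤i
  ... | inj₁ x<i = inj₁ (inj₂ x<i)
  ... | inj₂ x≡i = inj₂ (toℕ-injective (trans x≡i (sym (toℕ-fromℕ< i<N))))

  extendUpTo : ∀ i → i ≤ N →
    ∃ λ H → (∀ x → P x → H x ≡ h x) × InjectiveOn (Settled i) H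
  extendUpTo zero _ = h , (λ _ _ → refl) , injective-on-P
    where
    injective-on-P : InjectiveOn (Settled 0) h
    injective-on-P (inj₁ Px) (inj₁ Py) = h-injective Px Py
  extendUpTo (suc i) i<N with extendUpTo i (ℕ.<⇒≤ i<N)
  ... | H , agree , inj with addPoint (Settled? i) H inj (fromℕ< i<N)
  ...   | H′ , unchanged , inj′ =
    H′ , (λ x Px → trans (unchanged x (inj₁ Px)) (agree x Px))
       , λ sx sy → inj′ (settled-suc i<N sx) (settled-suc i<N sy)

  extendInjection : ∃ λ H → (∀ x → P x → H x ≡ h x) × Injective _≡_ _≡_ H
  extendInjection with extendUpTo N ≤-refl
  ... | H , agree , inj = H , agree , λ {x} {y} → inj (inj₂ (toℕ<n x)) (inj₂ (toℕ<n y))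

laterLegs : {k : ℕ} → (Fin (suc k) → ℕ) → Fin k → ℕ
laterLegs m j = m (suc j)

laterEdge : {k : ℕ} {m : Fin (suc k) → ℕ} → Edge (laterLegs m) → Edge m
laterEdge (j , p) = suc j , p

edgeAt : (k : ℕ) (m : Fin k → ℕ) → Fin (sumLegs k m) → Edge m
edgeAt (suc k) m i =
  [ (λ p → zero , p) , laterEdge ∘ edgeAt k (laterLegs m) ]′ (splitAt (m zero) i)

edgeIndex : (k : ℕ) (m : Fin k → ℕ) → Edge m → Fin (sumLegs k m)
edgeIndex (suc k) m (zero  , p) = join (m zero) _ (inj₁ p)
edgeIndex (suc k) m (suc j , p) = join (m zero) _ (inj₂ (edgeIndex k (laterLegs m) (j , p)))

edgeAt-edgeIndex : ∀ k m (e : Edge m) → edgeAt k m (edgeIndex k m e) ≡ e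
edgeAt-edgeIndex (suc k) m (zero , p)
  rewrite splitAt-join (m zero) (sumLegs k (laterLegs m)) (inj₁ p) = refl
edgeAt-edgeIndex (suc k) m (suc j , p)
  rewrite splitAt-join (m zero) (sumLegs k (laterLegs m)) (inj₂ (edgeIndex k (laterLegs m) (j , p)))
        | edgeAt-edgeIndex k (laterLegs m) (j , p) = refl

edgeIndex-edgeAt : ∀ k m (i : Fin (sumLegs k m)) → edgeIndex k m (edgeAt k m i) ≡ i
edgeIndex-edgeAt (suc k) m i with splitAt (m zero) i in split
... | inj₁ p = splitAt⁻¹-↑ˡ split
... | inj₂ q with edgeAt k (laterLegs m) q | edgeIndex-edgeAt k (laterLegs m) q
...   | j , p | refl = splitAt⁻¹-↑ʳ split

*-2^suc : ∀ c s → c * 2 ^ suc s ≡ 2 * (c * 2 ^ s)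
*-2^suc c s = begin
  c * (2 * 2 ^ s) ≡⟨ ℕ.*-assoc c 2 (2 ^ s) ⟨
  c * 2 * 2 ^ s   ≡⟨ cong (_* 2 ^ s) (ℕ.*-comm c 2) ⟩
  2 * c * 2 ^ s   ≡⟨ ℕ.*-assoc 2 c (2 ^ s) ⟩
  2 * (c * 2 ^ s) ∎
  where open ≡-Reasoning

odd≢c*2^suc : ∀ a c t → (2 * a + 1) * 2 ^ 0 ≢ c * 2 ^ suc t
odd≢c*2^suc a c t eq = ℕ.even≢odd (c * 2 ^ t) a (begin
  2 * (c * 2 ^ t)     ≡⟨ *-2^suc c t ⟨
  c * 2 ^ suc t       ≡⟨ eq ⟨
  (2 * a + 1) * 1     ≡⟨ ℕ.*-identityʳ (2 * a + 1) ⟩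
  2 * a + 1           ≡⟨ ℕ.+-comm (2 * a) 1 ⟩
  suc (2 * a)         ∎)
  where open ≡-Reasoning

odd*2^-injective : ∀ a b s t → (2 * a + 1) * 2 ^ s ≡ (2 * b + 1) * 2 ^ t → a ≡ b × s ≡ t
odd*2^-injective a b zero zero eq =
  ℕ.*-cancelˡ-≡ a b 2 (ℕ.+-cancelʳ-≡ _ _ _
    (trans (sym (ℕ.*-identityʳ _)) (trans eq (ℕ.*-identityʳ _)))) , refl
odd*2^-injective a b zero    (suc t) eq = ⊥-elim (odd≢c*2^suc a (2 * b + 1) t eq)
odd*2^-injective a b (suc s) zero    eq = ⊥-elim (odd≢c*2^suc b (2 * a + 1) s (sym eq))
odd*2^-injective a b (suc s) (suc t) eq
  with odd*2^-injective a b s t (ℕ.*-cancelˡ-≡ _ _ 2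
         (trans (sym (*-2^suc (2 * a + 1) s)) (trans eq (*-2^suc (2 * b + 1) t))))
... | a≡b , s≡t = a≡b , cong suc s≡t

∸-suc : ∀ {m n} → n < m → m ∸ n ≡ suc (m ∸ suc n)
∸-suc {suc m} {zero}  _         = refl
∸-suc {suc m} {suc n} (s≤s n<m) = ∸-suc n<m

toℕ-subst : ∀ {a b} (a≡b : a ≡ b) (x : Fin a) → toℕ (subst Fin a≡b x) ≡ toℕ x
toℕ-subst refl x = refl

absDiff-double : ∀ c → absDiff (2 * c) c ≡ c
absDiff-double c rewrite ℕ.+-identityʳ c
  | ℕ.m+n∸n≡m c c | ℕ.m≤n⇒m∸n≡0 (ℕ.m≤m+n c c) = ℕ.+-identityʳ c

module DyadicLabeling (k : ℕ) (m : Fin k → ℕ)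
  (hyp : ∀ j → m j ≤ 1 ⊎ (2 * toℕ j + 1) * 2 ^ (m j ∸ 1) ≤ sumLegs k m) where

  n : ℕ
  n = sumLegs k m

  height : Edge m → ℕ
  height (j , p) = m j ∸ suc (toℕ p)

  dyadic : Edge m → ℕ
  dyadic e = (2 * toℕ (proj₁ e) + 1) * 2 ^ height e

  Long : Edge m → Set
  Long (j , _) = 2 ≤ m j

  Long? : Decidable Long
  Long? (j , _) = 2 ℕ.≤? m j

  suc-pred-dyadic : ∀ e → suc (pred (dyadic e)) ≡ dyadic e
  suc-pred-dyadic e = ℕ.suc-pred (dyadic e) {{ℕ.>-nonZero positive}}
    where
    positive : 1 ≤ dyadic e
    positive = ℕ.*-mono-≤ (ℕ.m≤n+m 1 (2 * toℕ (proj₁ e))) (ℕ.m^n>0 2 (height e))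

  dyadic-bound : ∀ e → Long e → dyadic e ≤ n
  dyadic-bound (j , p) long with hyp j
  ... | inj₁ short = contradiction (≤-trans long short) ℕ.1+n≰n
  ... | inj₂ bound = ≤-trans (ℕ.*-monoʳ-≤ (2 * toℕ j + 1)
                               (ℕ.^-monoʳ-≤ 2 (ℕ.∸-monoʳ-≤ (m j) (s≤s z≤n)))) bound

  dyadic-index<n : ∀ e → Long e → pred (dyadic e) < n
  dyadic-index<n e long = subst (_≤ n) (sym (suc-pred-dyadic e)) (dyadic-bound e long)

  -- Distinct edges have distinct dyadic labels: the odd part determines the
  -- leg and the power of two the position on it.
  dyadic-injective : ∀ e e′ → dyadic e ≡ dyadic e′ → e ≡ e′
  dyadic-injective (j , p) (j′ , p′) eq
    with odd*2^-injective (toℕ j) (toℕ j′) (height (j , p)) (height (j′ , p′)) eq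
  ... | j≡j′ , heights with toℕ-injective j≡j′
  ... | refl = cong (j ,_) (toℕ-injective (ℕ.suc-injective
                 (ℕ.∸-cancelˡ-≡ (toℕ<n p) (toℕ<n p′) heights)))

  height-step : ∀ j (p₁ p₂ : Fin (m j)) → toℕ p₂ ≡ suc (toℕ p₁) →
    height (j , p₁) ≡ suc (height (j , p₂))
  height-step j p₁ p₂ p₂≡ rewrite p₂≡ = ∸-suc (subst (_< m j) p₂≡ (toℕ<n p₂))

  dyadic-step : ∀ j (p₁ p₂ : Fin (m j)) → toℕ p₂ ≡ suc (toℕ p₁) →
    dyadic (j , p₁) ≡ 2 * dyadic (j , p₂)
  dyadic-step j p₁ p₂ p₂≡ =
    trans (cong (λ h → (2 * toℕ j + 1) * 2 ^ h) (height-step j p₁ p₂ p₂≡))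
          (*-2^suc (2 * toℕ j + 1) (height (j , p₂)))

  -- The prescribed part of the labeling, transported to Fin n (label - 1).
  Prescribed : Fin n → Set
  Prescribed i = Long (edgeAt k m i)

  prescribed : Fin n → Fin n
  prescribed i with Long? (edgeAt k m i)
  ... | yes long = fromℕ< (dyadic-index<n (edgeAt k m i) long)
  ... | no  _    = i

  prescribed-dyadic : ∀ i → Prescribed i →
    suc (toℕ (prescribed i)) ≡ dyadic (edgeAt k m i)
  prescribed-dyadic i long with Long? (edgeAt k m i)
  ... | yes _     = trans (cong suc (toℕ-fromℕ< _)) (suc-pred-dyadic (edgeAt k m i))
  ... | no  short = contradiction long short

  prescribed-injective : InjectiveOn Prescribed prescribed
  prescribed-injective {x} {y} px py eq = begin
    x                              ≡⟨ edgeIndex-edgeAt k m x ⟨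
    edgeIndex k m (edgeAt k m x)   ≡⟨ cong (edgeIndex k m) same-edge ⟩
    edgeIndex k m (edgeAt k m y)   ≡⟨ edgeIndex-edgeAt k m y ⟩
    y                              ∎
    where
    open ≡-Reasoning
    same-edge : edgeAt k m x ≡ edgeAt k m y
    same-edge = dyadic-injective _ _ (trans (sym (prescribed-dyadic x px))
                  (trans (cong (suc ∘ toℕ) eq) (prescribed-dyadic y py)))

  completion : ∃ λ H → (∀ x → Prescribed x → H x ≡ prescribed x) × Injective _≡_ _≡_ H
  completion = extendInjection (Long? ∘ edgeAt k m) prescribed prescribed-injective

  H : Fin n → Fin n
  H = proj₁ completion

  H-prescribed : ∀ x → Prescribed x → H x ≡ prescribed x
  H-prescribed = proj₁ (proj₂ completion)

  H-injective : Injective _≡_ _≡_ H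
  H-injective = proj₂ (proj₂ completion)

  outerLabel : Edge m → ℕ
  outerLabel e = suc (toℕ (H (edgeIndex k m e)))

  outerLabel-dyadic : ∀ e → Long e → outerLabel e ≡ dyadic e
  outerLabel-dyadic e long = begin
    suc (toℕ (H i))          ≡⟨ cong (suc ∘ toℕ) (H-prescribed i long′) ⟩
    suc (toℕ (prescribed i)) ≡⟨ prescribed-dyadic i long′ ⟩
    dyadic (edgeAt k m i)    ≡⟨ cong dyadic (edgeAt-edgeIndex k m e) ⟩
    dyadic e                 ∎
    where
    open ≡-Reasoning
    i = edgeIndex k m e
    long′ : Prescribed i
    long′ = subst Long (sym (edgeAt-edgeIndex k m e)) long

  outerLabel-injective : ∀ e e′ → outerLabel e ≡ outerLabel e′ → e ≡ e′
  outerLabel-injective e e′ eq = begin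
    e                                ≡⟨ edgeAt-edgeIndex k m e ⟨
    edgeAt k m (edgeIndex k m e)     ≡⟨ cong (edgeAt k m) same-index ⟩
    edgeAt k m (edgeIndex k m e′)    ≡⟨ edgeAt-edgeIndex k m e′ ⟩
    e′                               ∎
    where
    open ≡-Reasoning
    same-index : edgeIndex k m e ≡ edgeIndex k m e′
    same-index = H-injective (toℕ-injective (ℕ.suc-injective eq))

  spiderLabel : Vertex m → ℕ
  spiderLabel center     = 0
  spiderLabel (legV j p) = outerLabel (j , p)

  outerLabel-step : ∀ j (p₁ p₂ : Fin (m j)) → toℕ p₂ ≡ suc (toℕ p₁) →
    outerLabel (j , p₁) ≡ 2 * outerLabel (j , p₂)
  outerLabel-step j p₁ p₂ p₂≡ = begin
    outerLabel (j , p₁)     ≡⟨ outerLabel-dyadic (j , p₁) long ⟩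
    dyadic (j , p₁)         ≡⟨ dyadic-step j p₁ p₂ p₂≡ ⟩
    2 * dyadic (j , p₂)     ≡⟨ cong (2 *_) (outerLabel-dyadic (j , p₂) long) ⟨
    2 * outerLabel (j , p₂) ∎
    where
    open ≡-Reasoning
    long : 2 ≤ m j
    long = ≤-trans (s≤s (subst (1 ≤_) (sym p₂≡) (s≤s z≤n))) (toℕ<n p₂)

  -- Every edge is labelled with the label of its outer endpoint.  Positions
  -- in Fin (m j) cannot be split directly, so, as in Defs.innerAux, the
  -- bound is generalised to any l with l ≡ m j.
  edgeLabel-outer : ∀ j {l} (eq : l ≡ m j) (p : Fin l) →
    absDiff (spiderLabel (innerAux j eq p)) (outerLabel (j , subst Fin eq p))
      ≡ outerLabel (j , subst Fin eq p)
  edgeLabel-outer j eq zero    = refl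
  edgeLabel-outer j eq (suc p) = begin
    absDiff (outerLabel (j , p₁)) c  ≡⟨ cong (λ a → absDiff a c) (outerLabel-step j p₁ p₂ consecutive) ⟩
    absDiff (2 * c) c                ≡⟨ absDiff-double c ⟩
    c                                ∎
    where
    open ≡-Reasoning
    p₁ p₂ : Fin (m j)
    p₁ = subst Fin eq (inject₁ p)
    p₂ = subst Fin eq (suc p)
    c : ℕ
    c = outerLabel (j , p₂)
    consecutive : toℕ p₂ ≡ suc (toℕ p₁)
    consecutive = trans (toℕ-subst eq (suc p))
                        (cong suc (sym (trans (toℕ-subst eq (inject₁ p)) (toℕ-inject₁ p))))

  edgeLabel≡outerLabel : ∀ e → edgeLabel spiderLabel e ≡ outerLabel e
  edgeLabel≡outerLabel (j , p) = edgeLabel-outer j refl p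

  spiderLabel-injective : Injective _≡_ _≡_ spiderLabel
  spiderLabel-injective {center}   {center}     _  = refl
  spiderLabel-injective {legV j p} {legV j′ p′} eq
    with outerLabel-injective (j , p) (j′ , p′) eq
  ... | refl = refl

  -- Since H is a permutation of Fin n, the outer labels are exactly {1, …, n}.
  spiderLabel-graceful : IsGraceful m n spiderLabel
  spiderLabel-graceful = record
    { injective  = spiderLabel-injective
    ; bounded    = bounded
    ; labelsIn   = λ e → subst (λ d → 1 ≤ d × d ≤ n) (sym (edgeLabel≡outerLabel e))
                                 (s≤s z≤n , toℕ<n (H (edgeIndex k m e)))
    ; labelsOnto = onto
    }
    where
    bounded : ∀ x → spiderLabel x ≤ n
    bounded center     = z≤n
    bounded (legV j p) = toℕ<n (H (edgeIndex k m (j , p)))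

    onto : ∀ d → 1 ≤ d → d ≤ n → ∃[ e ] edgeLabel spiderLabel e ≡ d
    onto (suc d) _ d<n with injective⇒surjective H H-injective (fromℕ< d<n)
    ... | i , Hi≡d = edgeAt k m i , (begin
      edgeLabel spiderLabel (edgeAt k m i)  ≡⟨ edgeLabel≡outerLabel (edgeAt k m i) ⟩
      outerLabel (edgeAt k m i)             ≡⟨ cong (suc ∘ toℕ ∘ H) (edgeIndex-edgeAt k m i) ⟩
      suc (toℕ (H i))                       ≡⟨ cong (suc ∘ toℕ) Hi≡d ⟩
      suc (toℕ (fromℕ< d<n))                ≡⟨ cong suc (toℕ-fromℕ< d<n) ⟩
      suc d                                 ∎)
      where open ≡-Reasoning

mainTheorem7 : (k : ℕ) (m : Fin k → ℕ) (n : ℕ) →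
    (∀ j → 1 ≤ m j) →
    (∀ i j → toℕ i ≤ toℕ j → m j ≤ m i) →
    sumLegs k m ≡ n →
    (∀ j → m j ≤ 1 ⊎ (2 * toℕ j + 1) * 2 ^ (m j ∸ 1) ≤ n) →
    ∃[ f ] (IsGraceful m n f × f center ≡ 0)
mainTheorem7 k m .(sumLegs k m) _ _ refl hyp = spiderLabel , spiderLabel-graceful , refl
  where open DyadicLabeling k m hyp
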